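{- The morphism $\psi_1$ is square-free over grounded words; that is, $\psi_1$ is non-erasing and $\psi_1(w)$ is square-free for every square-free grounded word $w$.
   Context: Words are over $\mathbb{N}=\{0,1,2,\dots\}$, letters written as numerals; positions indexed from $0$. For a word $w$, $w[:-k]$ denotes $w$ with its last $k$ letters removed. A square is a nonempty word $yy$; a word is square-free if it has no square factor. A word $w=w_0w_1\cdots$ is even-grounded if $w_i=0$ for all even $i$ and $w_i\neq 0$ for all odd $i$; odd-grounded if $w_i=0$ for odd $i$ and $w_i\ne 0$ for even $i$; grounded if it is even- or odd-grounded. The ruler morphism is $\rho(n)=0\,(n+1)$ and $R_n=\rho^n(0)$ (so $R_0=0$, $R_1=01$, $R_2=0102$, ...). Let $P_0(n)=R_{n+1}[:-2]$. The morphism $\psi_1$ is defined by $\psi_1(0)=202101$ and $\psi_1(n)=(n+1)\,P_0(n+1)$ for letters $n\ge1$. -}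

module Defs where

open import Data.Nat using (ℕ; zero; suc)
open import Data.List using (List; []; _∷_; _++_; concatMap; length; take; _∷ʳ_)
open import Data.List.Base using (reverse; drop)
open import Data.Product using (Σ; ∃; _×_; _,_)
open import Data.Sum using (_⊎_)
open import Data.Unit using (⊤)
open import Relation.Nullary using (¬_)
open import Relation.Binary.PropositionalEquality using (_≡_; _≢_)

Word : Set
Word = List ℕ

ρ : ℕ → Word
ρ n = 0 ∷ suc n ∷ []

ρ* : Word → Word
ρ* = concatMap ρ

R : ℕ → Word
R zero = 0 ∷ []
R (suc n) = ρ* (R n)

dropLast : ℕ → Word → Word
dropLast k w = reverse (drop k (reverse w))

P₀ : ℕ → Word
P₀ n = dropLast 2 (R (suc n))

ψ₁ : ℕ → Word
ψ₁ zero = 2 ∷ 0 ∷ 2 ∷ 1 ∷ 0 ∷ 1 ∷ []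
ψ₁ (suc n) = suc (suc n) ∷ P₀ (suc (suc n))

ψ₁* : Word → Word
ψ₁* = concatMap ψ₁

SquareFree : Word → Set
SquareFree w = ¬ (Σ Word λ u → Σ Word λ y → Σ Word λ v →
                  (y ≢ []) × (w ≡ u ++ (y ++ y) ++ v))

mutual
  EvenGrounded : Word → Set
  EvenGrounded [] = ⊤
  EvenGrounded (x ∷ xs) = (x ≡ 0) × OddGrounded xs

  OddGrounded : Word → Set
  OddGrounded [] = ⊤
  OddGrounded (x ∷ xs) = (x ≢ 0) × EvenGrounded xs

Grounded : Word → Set
Grounded w = EvenGrounded w ⊎ OddGrounded w

NonErasing : (ℕ → Word) → Set
NonErasing h = (n : ℕ) → h n ≢ []

SquareFreeOverGrounded : (ℕ → Word) → Set
SquareFreeOverGrounded h =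
  NonErasing h × ((w : Word) → SquareFree w → Grounded w → SquareFree (concatMap h w))

module Submission where

-- In a square-free grounded word the letters alternate between 0 and nonzero letters, and
-- under this constraint the images ψ₁ b can be parsed uniquely: every block ends with 1, the
-- factor 202 occurs only at the start of a block ψ₁ 0, and the first letter of a block together
-- with the parity of its position determines the letter. A square in ψ₁*(w) that starts at a
-- block boundary therefore pulls back to a square in w. A square starting strictly inside a
-- block either resynchronises, again giving a square in w, or forces a factor 202 or 21 at a
-- place where the ruler-like shape of ψ₁ (n+1) = (n+2) P(n+2) forbids it; the relevant
-- neighbourhoods of the blocks are square-free because they are built around unique
-- largest letters.

open import Defs
open import Data.Nat using (ℕ; zero; suc; _+_; _≤_; _<_; _≟_; _<?_; s≤s)
open import Data.Nat.Properties using (+-suc; m≤m+n; suc-injective; ≤-refl; <⇒≤; >⇒≢; <-trans; n<1+n; <-cmp; <-irrefl; m≤n⇒m<n∨m≡n)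
open import Data.Fin using (Fin; toℕ; fromℕ<)
open import Data.Fin.Properties using (any?; toℕ-fromℕ<)
open import Data.List using ([]; _∷_; _++_; length; take; filter; initLast; _∷ʳ′_)
open import Data.List.Properties
  using (++-assoc; ++-identityʳ; ++-cancelˡ; ++-cancelʳ; ++-conicalˡ; ++-conicalʳ; ∷ʳ-injective; ∷-injective; ∷-injectiveˡ;
         ∷-injectiveʳ; length-++; ++-monoid; concatMap-++; reverse-++; reverse-involutive; filter-++; filter-accept; filter-reject)
open import Data.List.Membership.Propositional using (_∈_; _∉_)
open import Data.List.Membership.Propositional.Properties using (∈-++⁻; ∈-++⁺ʳ)
open import Data.List.Relation.Unary.Any using (here; there)
open import Data.List.Relation.Unary.All as All using (all?)
open import Data.List.Relation.Binary.Pointwise using (Pointwise-≡⇒≡; ≡⇒Pointwise-≡)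
open import Data.List.Relation.Binary.Prefix.Heterogeneous using (Prefix; toView; fromView)
  renaming (_++_ to _++ᵛ_)
open import Data.List.Relation.Binary.Prefix.Heterogeneous.Properties using (prefix?)
open import Data.List.Relation.Binary.Infix.Heterogeneous using (Infix; MkView)
  renaming (toView to infixView; fromView to fromInfixView)
open import Data.List.Relation.Binary.Infix.Heterogeneous.Properties using (infix?)
open import Data.Product using (Σ; _×_; _,_; proj₁; proj₂)
open import Data.Bool using (Bool; true; false; not)
open import Data.Sum using (_⊎_; inj₁; inj₂; [_,_]′)
open import Data.Empty using (⊥; ⊥-elim)
open import Data.Unit using (tt)
open import Relation.Binary using (tri<; tri≈; tri>)
open import Relation.Nullary using (¬_; Dec; yes; no)
open import Relation.Nullary.Decidable using (map′; ¬?; _×-dec_; toWitness; toWitnessFalse; True; False)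
open import Relation.Binary.PropositionalEquality hiding ([_])
open ≡-Reasoning
open import Function using (_∘_)
open import Tactic.MonoidSolver using (solve)

levi : ∀ (a b c d : Word) → a ++ b ≡ c ++ d →
  (Σ Word λ m → c ≡ a ++ m × b ≡ m ++ d) ⊎
  (Σ Word λ m → a ≡ c ++ m × d ≡ m ++ b × m ≢ [])
levi [] b c d eq = inj₁ (c , refl , eq)
levi (x ∷ a) b [] d eq = inj₂ (x ∷ a , refl , sym eq , λ ())
levi (x ∷ a) b (y ∷ c) d eq with refl , eq′ ← ∷-injective eq with levi a b c d eq′
... | inj₁ (m , c≡am , b≡md) = inj₁ (m , cong (x ∷_) c≡am , b≡md)
... | inj₂ (m , a≡cm , d≡mb , m≢[]) = inj₂ (m , cong (x ∷_) a≡cm , d≡mb , m≢[])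

∷-++-cancelʳ : ∀ (A B T : Word) {a b} → A ++ a ∷ T ≡ B ++ b ∷ T → A ≡ B × a ≡ b
∷-++-cancelʳ A B T {a} {b} e = ∷ʳ-injective A B (++-cancelʳ T (A ++ a ∷ []) (B ++ b ∷ [])
  (trans (++-assoc A (a ∷ []) T) (trans e (sym (++-assoc B (b ∷ []) T)))))

∷ʳ-suffix : ∀ X (E m : Word) {a} → X ++ a ∷ [] ≡ E ++ m → m ≢ [] → Σ Word λ m′ → m ≡ m′ ++ a ∷ []
∷ʳ-suffix X E m e m≢[] with initLast m
... | [] = ⊥-elim (m≢[] refl)
... | m′ ∷ʳ′ l with _ , refl ← ∷ʳ-injective X (E ++ m′) (trans e (sym (++-assoc E m′ _))) = m′ , refl

Factor : Word → Word → Set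
Factor f w = Σ Word λ u → Σ Word λ v → w ≡ u ++ f ++ v

factor-trans : ∀ {f g w} → Factor f g → Factor g w → Factor f w
factor-trans {f} (u , v , refl) (u′ , v′ , refl) = u′ ++ u , v ++ v′ , regroup u′ u f v v′
  where
  regroup : ∀ (U′ U F V V′ : Word) → U′ ++ (U ++ F ++ V) ++ V′ ≡ (U′ ++ U) ++ F ++ V ++ V′
  regroup _ _ _ _ _ = solve (++-monoid ℕ)

prefix-factor : ∀ f v → Factor f (f ++ v)
prefix-factor f v = [] , v , refl

suffix-factor : ∀ u f → Factor f (u ++ f)
suffix-factor u f = u , [] , cong (u ++_) (sym (++-identityʳ f))

square-factor : ∀ {w y} → SquareFree w → y ≢ [] → ¬ Factor (y ++ y) w
square-factor sf y≢[] (u , v , e) = sf (u , _ , v , y≢[] , e)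

squareFree-factor : ∀ {f w} → SquareFree w → Factor f w → SquareFree f
squareFree-factor sf f⊑w (u , y , v , y≢[] , e) = square-factor sf y≢[] (factor-trans (u , v , e) f⊑w)

prefix⇒++ : ∀ {t s : Word} → Prefix _≡_ t s → Σ Word λ v → s ≡ t ++ v
prefix⇒++ p with ps ++ᵛ v ← toView p = v , cong (_++ v) (sym (Pointwise-≡⇒≡ ps))

++⇒prefix : ∀ (t v : Word) → Prefix _≡_ t (t ++ v)
++⇒prefix t v = fromView (≡⇒Pointwise-≡ refl ++ᵛ v)

factor? : ∀ f w → Dec (Factor f w)
factor? f w = map′ fromInfix toInfix (infix? _≟_ f w)
  where
  fromInfix : Infix _≡_ f w → Factor f w
  fromInfix i with MkView u ps v ← infixView i = u , v , cong (λ t → u ++ t ++ v) (sym (Pointwise-≡⇒≡ ps))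
  toInfix : Factor f w → Infix _≡_ f w
  toInfix (u , v , refl) = fromInfixView (MkView u (≡⇒Pointwise-≡ refl) v)

¬factor-by-computation : ∀ f w → {False (factor? f w)} → ¬ Factor f w
¬factor-by-computation f w {p} = toWitnessFalse p

SquarePrefix : Word → Set
SquarePrefix s = Σ Word λ y → y ≢ [] × Prefix _≡_ (y ++ y) s

take-length-++ : ∀ (y r : Word) → take (length y) (y ++ r) ≡ y
take-length-++ [] r = refl
take-length-++ (x ∷ y) r = cong (x ∷_) (take-length-++ y r)

squarePrefix? : ∀ s → Dec (SquarePrefix s)
squarePrefix? [] = no λ where
  ([] , y≢[] , _) → y≢[] refl
  (_ ∷ _ , _ , ())
squarePrefix? (x ∷ s) = map′ fromCandidate toCandidate (any? λ i → prefix? _≟_ (half i ++ half i) (x ∷ s))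
  where
  half : Fin (length (x ∷ s)) → Word
  half i = x ∷ take (toℕ i) s
  fromCandidate : Σ (Fin (length (x ∷ s))) (λ i → Prefix _≡_ (half i ++ half i) (x ∷ s)) → SquarePrefix (x ∷ s)
  fromCandidate (i , p) = half i , (λ ()) , p
  toCandidate : SquarePrefix (x ∷ s) → Σ (Fin (length (x ∷ s))) (λ i → Prefix _≡_ (half i ++ half i) (x ∷ s))
  toCandidate ([] , y≢[] , _) = ⊥-elim (y≢[] refl)
  toCandidate (a ∷ y , _ , p) with v , e ← prefix⇒++ p with refl , s≡ ← ∷-injective e =
    i , subst (λ h → Prefix _≡_ (h ++ h) (x ∷ s)) (sym half-i) p
    where
    i<n : length y < length (x ∷ s)
    i<n rewrite s≡ | ++-assoc y (x ∷ y) v | length-++ y {x ∷ y ++ v} = s≤s (m≤m+n _ _)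
    i : Fin (length (x ∷ s))
    i = fromℕ< i<n
    half-i : half i ≡ x ∷ y
    half-i rewrite toℕ-fromℕ< i<n | s≡ | ++-assoc y (x ∷ y) v = cong (x ∷_) (take-length-++ y _)

squareFree? : ∀ w → Dec (SquareFree w)
squareFree? [] = yes λ where
  (u , [] , v , y≢[] , _) → y≢[] refl
  ([] , _ ∷ _ , v , _ , ())
  (_ ∷ _ , _ , v , _ , ())
squareFree? (x ∷ w) = map′ combine split (¬? (squarePrefix? (x ∷ w)) ×-dec squareFree? w)
  where
  combine : ¬ SquarePrefix (x ∷ w) × SquareFree w → SquareFree (x ∷ w)
  combine (¬sq , sf) ([] , y , v , y≢[] , e) = ¬sq (y , y≢[] , subst (Prefix _≡_ (y ++ y)) (sym e) (++⇒prefix (y ++ y) v))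
  combine (¬sq , sf) (_ ∷ u , y , v , y≢[] , e) = sf (u , y , v , y≢[] , ∷-injectiveʳ e)
  split : SquareFree (x ∷ w) → ¬ SquarePrefix (x ∷ w) × SquareFree w
  split sf = (λ (y , y≢[] , p) → let v , e = prefix⇒++ p in sf ([] , y , v , y≢[] , e))
           , (λ (u , y , v , y≢[] , e) → sf (x ∷ u , y , v , y≢[] , cong (x ∷_) e))

squareFree-by-computation : ∀ w → {True (squareFree? w)} → SquareFree w
squareFree-by-computation w {p} = toWitness p

∉-++ : ∀ {c : ℕ} A {B} → c ∉ A → c ∉ B → c ∉ A ++ B
∉-++ A c∉A c∉B c∈ with ∈-++⁻ A c∈
... | inj₁ c∈A = c∉A c∈A
... | inj₂ c∈B = c∉B c∈B

∉-∷ : ∀ {c x : ℕ} {w} → c ≢ x → c ∉ w → c ∉ x ∷ w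
∉-∷ c≢x c∉w (here c≡x) = c≢x c≡x
∉-∷ c≢x c∉w (there c∈w) = c∉w c∈w

factor-avoiding : ∀ {c f} A S → c ∉ f → Factor f (A ++ c ∷ S) → Factor f A ⊎ Factor f S
factor-avoiding {c} {f} A S c∉f (u , v , e) with levi A (c ∷ S) u (f ++ v) e
... | inj₁ (x ∷ m , _ , e′) with refl , S≡ ← ∷-injective e′ = inj₂ (m , v , S≡)
... | inj₁ ([] , _ , e′) with f
...   | [] = inj₁ (A , [] , sym (++-identityʳ A))
...   | x ∷ f′ with refl , _ ← ∷-injective e′ = ⊥-elim (c∉f (here refl))
factor-avoiding {f = f} A S c∉f (u , v , e) | inj₂ (m , A≡um , fv≡mcS , _) with levi f v m (_ ∷ S) fv≡mcS
... | inj₁ (m′ , m≡fm′ , _) = inj₁ (u , m′ , trans A≡um (cong (u ++_) m≡fm′))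
... | inj₂ ([] , _ , _ , m′≢[]) = ⊥-elim (m′≢[] refl)
... | inj₂ (x ∷ m′ , f≡mm′ , cS≡ , _) with refl , _ ← ∷-injective cS≡ =
  ⊥-elim (c∉f (subst (_ ∈_) (sym f≡mm′) (∈-++⁺ʳ m (here refl))))

letter-split-unique : ∀ {c : ℕ} P S P′ S′ → P ++ c ∷ S ≡ P′ ++ c ∷ S′ → c ∉ P → c ∉ P′ → P ≡ P′ × S ≡ S′
letter-split-unique [] S [] S′ e _ _ = refl , ∷-injectiveʳ e
letter-split-unique [] S (x ∷ P′) S′ e _ c∉P′ = ⊥-elim (c∉P′ (here (∷-injectiveˡ e)))
letter-split-unique (x ∷ P) S [] S′ e c∉P _ = ⊥-elim (c∉P (here (sym (∷-injectiveˡ e))))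
letter-split-unique (x ∷ P) S (y ∷ P′) S′ e c∉P c∉P′ with refl , e′ ← ∷-injective e
  with refl , refl ← letter-split-unique P S P′ S′ e′ (c∉P ∘ there) (c∉P′ ∘ there) = refl , refl

count : ℕ → Word → ℕ
count c w = length (filter (c ≟_) w)

count-++ : ∀ c xs ys → count c (xs ++ ys) ≡ count c xs + count c ys
count-++ c xs ys = trans (cong length (filter-++ (c ≟_) xs ys)) (length-++ (filter (c ≟_) xs))

count-here : ∀ c w → count c (c ∷ w) ≡ suc (count c w)
count-here c w = cong length (filter-accept (c ≟_) refl)

count-other : ∀ {c x} w → c ≢ x → count c (x ∷ w) ≡ count c w
count-other {c} w c≢x = cong length (filter-reject (c ≟_) c≢x)

∉⇒count≡0 : ∀ {c} w → c ∉ w → count c w ≡ 0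
∉⇒count≡0 [] _ = refl
∉⇒count≡0 (x ∷ w) c∉ = trans (count-other w (c∉ ∘ here)) (∉⇒count≡0 w (c∉ ∘ there))

count≡0⇒∉ : ∀ {c} w → count c w ≡ 0 → c ∉ w
count≡0⇒∉ {c} (x ∷ w) e c∈ with c ≟ x
... | yes refl with () ← trans (sym (count-here c w)) e
... | no c≢x with c∈
...   | here c≡x = c≢x c≡x
...   | there c∈w = count≡0⇒∉ w (trans (sym (count-other w c≢x)) e) c∈w

count≡1⇒split : ∀ c y → count c y ≡ 1 → Σ Word λ y₁ → Σ Word λ y₂ → y ≡ y₁ ++ c ∷ y₂ × c ∉ y₁ × c ∉ y₂
count≡1⇒split c (x ∷ y) e with c ≟ x
... | yes refl = [] , y , refl , (λ ()) , count≡0⇒∉ y (suc-injective (trans (sym (count-here c y)) e))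
... | no c≢x with y₁ , y₂ , refl , c∉y₁ , c∉y₂ ← count≡1⇒split c y (trans (sym (count-other y c≢x)) e) =
  x ∷ y₁ , y₂ , refl , ∉-∷ c≢x c∉y₁ , c∉y₂

count-separated : ∀ {c} A S → c ∉ A → count c (A ++ c ∷ S) ≡ suc (count c S)
count-separated {c} A S c∉A = begin
  count c (A ++ c ∷ S)        ≡⟨ count-++ c A (c ∷ S) ⟩
  count c A + count c (c ∷ S) ≡⟨ cong₂ _+_ (∉⇒count≡0 A c∉A) (count-here c S) ⟩
  suc (count c S)             ∎

count-square : ∀ c u y v → count c (u ++ (y ++ y) ++ v) ≡ count c u + ((count c y + count c y) + count c v)
count-square c u y v rewrite count-++ c u ((y ++ y) ++ v) | count-++ c (y ++ y) v | count-++ c y y = refl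

a+2b+d≡1⇒b≡0 : ∀ a b d → a + ((b + b) + d) ≡ 1 → b ≡ 0
a+2b+d≡1⇒b≡0 a zero d e = refl
a+2b+d≡1⇒b≡0 a (suc b) d e rewrite +-suc b b | +-suc a (suc ((b + b) + d)) | +-suc a ((b + b) + d) with () ← e

a+2b+d≡2⇒b≡0⊎b≡1×a≡0 : ∀ a b d → a + ((b + b) + d) ≡ 2 → b ≡ 0 ⊎ (b ≡ 1 × a ≡ 0)
a+2b+d≡2⇒b≡0⊎b≡1×a≡0 a zero d e = inj₁ refl
a+2b+d≡2⇒b≡0⊎b≡1×a≡0 zero (suc zero) d e = inj₂ (refl , refl)
a+2b+d≡2⇒b≡0⊎b≡1×a≡0 (suc a) (suc zero) d e rewrite +-suc a (suc d) | +-suc a d with () ← e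
a+2b+d≡2⇒b≡0⊎b≡1×a≡0 a (suc (suc b)) d e rewrite +-suc b (suc b) | +-suc b b
  | +-suc a (suc (suc (suc ((b + b) + d)))) | +-suc a (suc (suc ((b + b) + d)))
  | +-suc a (suc ((b + b) + d)) with () ← e

squareFree-unique-letter : ∀ c A S → SquareFree A → SquareFree S → c ∉ A → c ∉ S → SquareFree (A ++ c ∷ S)
squareFree-unique-letter c A S sfA sfS c∉A c∉S (u , y , v , y≢[] , e)
  with factor-avoiding A S (∉-++ y c∉y c∉y) (u , v , e)
  where
  c∉y : c ∉ y
  c∉y = count≡0⇒∉ y (a+2b+d≡1⇒b≡0 (count c u) (count c y) (count c v)
          (trans (sym (count-square c u y v)) (trans (cong (count c) (sym e))
            (trans (count-separated A S c∉A) (cong suc (∉⇒count≡0 S c∉S))))))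
... | inj₁ f = square-factor sfA y≢[] f
... | inj₂ f = square-factor sfS y≢[] f

square-around-letter : ∀ (u y₁ C y₂ v : Word) →
  u ++ ((y₁ ++ C ++ y₂) ++ (y₁ ++ C ++ y₂)) ++ v ≡ (u ++ y₁) ++ C ++ (y₂ ++ y₁) ++ C ++ (y₂ ++ v)
square-around-letter _ _ _ _ _ = solve (++-monoid ℕ)

squareFree-two-letters : ∀ c A B C → SquareFree A → SquareFree B → SquareFree C → c ∉ A → c ∉ B → c ∉ C →
  (∀ u y₁ y₂ v → A ≡ u ++ y₁ → B ≡ y₂ ++ y₁ → C ≡ y₂ ++ v → ⊥) →
  SquareFree (A ++ c ∷ B ++ c ∷ C)
squareFree-two-letters c A B C sfA sfB sfC c∉A c∉B c∉C ¬aligned (u , y , v , y≢[] , e)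
  with a+2b+d≡2⇒b≡0⊎b≡1×a≡0 (count c u) (count c y) (count c v) counts
  where
  counts : count c u + ((count c y + count c y) + count c v) ≡ 2
  counts = begin
    count c u + ((count c y + count c y) + count c v) ≡⟨ count-square c u y v ⟨
    count c (u ++ (y ++ y) ++ v)                      ≡⟨ cong (count c) e ⟨
    count c (A ++ c ∷ B ++ c ∷ C)                     ≡⟨ count-separated A _ c∉A ⟩
    suc (count c (B ++ c ∷ C))                        ≡⟨ cong suc (count-separated B C c∉B) ⟩
    suc (suc (count c C))                             ≡⟨ cong (suc ∘ suc) (∉⇒count≡0 C c∉C) ⟩
    2                                                 ∎
... | inj₁ cy≡0 with c∉y ← count≡0⇒∉ y cy≡0 with factor-avoiding A (B ++ c ∷ C) (∉-++ y c∉y c∉y) (u , v , e)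
...   | inj₁ f = square-factor sfA y≢[] f
...   | inj₂ f with factor-avoiding B C (∉-++ y c∉y c∉y) f
...     | inj₁ f′ = square-factor sfB y≢[] f′
...     | inj₂ f′ = square-factor sfC y≢[] f′
squareFree-two-letters c A B C sfA sfB sfC c∉A c∉B c∉C ¬aligned (u , y , v , y≢[] , e)
  | inj₂ (cy≡1 , cu≡0) with y₁ , y₂ , refl , c∉y₁ , c∉y₂ ← count≡1⇒split c y cy≡1
  with refl , BcC≡ ← letter-split-unique A _ (u ++ y₁) _
         (trans e (square-around-letter u y₁ (c ∷ []) y₂ v)) c∉A (∉-++ u (count≡0⇒∉ u cu≡0) c∉y₁)
  with refl , refl ← letter-split-unique B C (y₂ ++ y₁) (y₂ ++ v) BcC≡ c∉B (∉-++ y₂ c∉y₂ c∉y₁)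
  = ¬aligned u y₁ y₂ v refl refl refl

-- Ruler words

ruler : ℕ → Word
ruler zero = []
ruler (suc m) = ruler m ++ m ∷ ruler m

P : ℕ → Word
P zero = []
P (suc m) = ruler (suc m) ++ suc m ∷ P m

ruler-suc : ∀ m → ruler (suc m) ≡ P m ++ 0 ∷ []
ruler-suc zero = refl
ruler-suc (suc m) = begin
  ruler (suc m) ++ suc m ∷ ruler (suc m)          ≡⟨ cong (λ t → ruler (suc m) ++ suc m ∷ t) (ruler-suc m) ⟩
  ruler (suc m) ++ suc m ∷ (P m ++ 0 ∷ [])        ≡⟨ ++-assoc (ruler (suc m)) (suc m ∷ P m) _ ⟨
  P (suc m) ++ 0 ∷ []                             ∎

ρ*-ruler : ∀ m → ρ* (ruler m) ++ 0 ∷ [] ≡ ruler (suc m)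
ρ*-ruler zero = refl
ρ*-ruler (suc m) = begin
  ρ* (ruler m ++ m ∷ ruler m) ++ 0 ∷ []           ≡⟨ cong (_++ 0 ∷ []) (concatMap-++ ρ (ruler m) (m ∷ ruler m)) ⟩
  (X ++ (0 ∷ []) ++ (suc m ∷ []) ++ X) ++ 0 ∷ []  ≡⟨ regroup X (0 ∷ []) (suc m ∷ []) ⟩
  (X ++ 0 ∷ []) ++ suc m ∷ (X ++ 0 ∷ [])          ≡⟨ cong (λ t → t ++ suc m ∷ t) (ρ*-ruler m) ⟩
  ruler (suc m) ++ suc m ∷ ruler (suc m)          ∎
  where
  X = ρ* (ruler m)
  regroup : ∀ (X Z K : Word) → (X ++ Z ++ K ++ X) ++ Z ≡ (X ++ Z) ++ K ++ (X ++ Z)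
  regroup _ _ _ = solve (++-monoid ℕ)

R≡ruler : ∀ m → R m ≡ ruler m ++ m ∷ []
R≡ruler zero = refl
R≡ruler (suc m) = begin
  ρ* (R m)                              ≡⟨ cong ρ* (R≡ruler m) ⟩
  ρ* (ruler m ++ m ∷ [])                ≡⟨ concatMap-++ ρ (ruler m) (m ∷ []) ⟩
  ρ* (ruler m) ++ 0 ∷ suc m ∷ []        ≡⟨ ++-assoc (ρ* (ruler m)) (0 ∷ []) _ ⟨
  (ρ* (ruler m) ++ 0 ∷ []) ++ suc m ∷ [] ≡⟨ cong (_++ suc m ∷ []) (ρ*-ruler m) ⟩
  ruler (suc m) ++ suc m ∷ []           ∎

dropLast-2 : ∀ X (a b : ℕ) → dropLast 2 (X ++ a ∷ b ∷ []) ≡ X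
dropLast-2 X a b rewrite reverse-++ X (a ∷ b ∷ []) = reverse-involutive X

P₀≡P : ∀ m → P₀ m ≡ P m
P₀≡P m = begin
  dropLast 2 (R (suc m))                          ≡⟨ cong (dropLast 2) (R≡ruler (suc m)) ⟩
  dropLast 2 (ruler (suc m) ++ suc m ∷ [])        ≡⟨ cong (λ t → dropLast 2 (t ++ suc m ∷ [])) (ruler-suc m) ⟩
  dropLast 2 ((P m ++ 0 ∷ []) ++ suc m ∷ [])      ≡⟨ cong (dropLast 2) (++-assoc (P m) (0 ∷ []) _) ⟩
  dropLast 2 (P m ++ 0 ∷ suc m ∷ [])              ≡⟨ dropLast-2 (P m) 0 (suc m) ⟩
  P m                                             ∎

ψ₁-suc : ∀ n → ψ₁ (suc n) ≡ suc (suc n) ∷ P (suc (suc n))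
ψ₁-suc n = cong (suc (suc n) ∷_) (P₀≡P (suc (suc n)))

∉-ruler : ∀ {c} m → m ≤ c → c ∉ ruler m
∉-ruler zero _ ()
∉-ruler (suc m) m<c = ∉-++ (ruler m) (∉-ruler m (<⇒≤ m<c)) (∉-∷ (>⇒≢ m<c) (∉-ruler m (<⇒≤ m<c)))

∉-P : ∀ {c} m → m < c → c ∉ P m
∉-P zero _ ()
∉-P (suc m) m<c = ∉-++ (ruler (suc m)) (∉-ruler (suc m) (<⇒≤ m<c)) (∉-∷ (>⇒≢ m<c) (∉-P m (<-trans (n<1+n m) m<c)))

squareFree-ruler : ∀ m → SquareFree (ruler m)
squareFree-ruler zero = squareFree-by-computation []
squareFree-ruler (suc m) =
  squareFree-unique-letter m (ruler m) (ruler m) (squareFree-ruler m) (squareFree-ruler m) (∉-ruler m ≤-refl) (∉-ruler m ≤-refl)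

P-ends-with-1 : ∀ m → Σ Word λ X → P (suc m) ≡ X ++ 1 ∷ []
P-ends-with-1 zero = 0 ∷ [] , refl
P-ends-with-1 (suc m) with X , e ← P-ends-with-1 m =
  ruler (2 + m) ++ 2 + m ∷ X , trans (cong (λ t → ruler (2 + m) ++ 2 + m ∷ t) e) (sym (++-assoc (ruler (2 + m)) (2 + m ∷ X) _))

ψ₁-ends-with-1 : ∀ b → Σ Word λ X → ψ₁ b ≡ X ++ 1 ∷ []
ψ₁-ends-with-1 zero = 2 ∷ 0 ∷ 2 ∷ 1 ∷ 0 ∷ [] , refl
ψ₁-ends-with-1 (suc n) with X , e ← P-ends-with-1 (suc n) = 2 + n ∷ X , trans (ψ₁-suc n) (cong (2 + n ∷_) e)

P-suffix : ∀ a b → a < b → Σ Word λ X → Σ ℕ λ j → P b ≡ X ++ j ∷ P a × a < j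
P-suffix a (suc b) (s≤s a≤b) with m≤n⇒m<n∨m≡n a≤b
... | inj₂ refl = ruler (suc a) , suc a , refl , n<1+n a
... | inj₁ a<b with X , j , e , a<j ← P-suffix a b a<b =
  ruler (suc b) ++ suc b ∷ X , j , trans (cong (λ t → ruler (suc b) ++ suc b ∷ t) e) (sym (++-assoc (ruler (suc b)) _ _)) , a<j

ψ₁-suffix-injective : ∀ α n m → ψ₁ (suc α) ≡ m ++ ψ₁ (suc n) → α ≡ n
ψ₁-suffix-injective α n m e with <-cmp α n
... | tri≈ _ α≡n _ = α≡n
... | tri< α<n _ _ with X , j , P≡ , _ ← P-suffix (2 + α) (2 + n) (s≤s (s≤s α<n))
  with () ← ++-conicalʳ m _ (sym (proj₁ (∷-++-cancelʳ [] (m ++ 2 + n ∷ X) (P (2 + α)) (begin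
    2 + α ∷ P (2 + α)                 ≡⟨ ψ₁-suc α ⟨
    ψ₁ (suc α)                        ≡⟨ e ⟩
    m ++ ψ₁ (suc n)                   ≡⟨ cong (m ++_) (trans (ψ₁-suc n) (cong (2 + n ∷_) P≡)) ⟩
    m ++ 2 + n ∷ X ++ j ∷ P (2 + α)   ≡⟨ ++-assoc m (2 + n ∷ X) _ ⟨
    (m ++ 2 + n ∷ X) ++ j ∷ P (2 + α) ∎))))
ψ₁-suffix-injective α n m e | tri> _ _ n<α with X , j , P≡ , n<j ← P-suffix (2 + n) (2 + α) (s≤s (s≤s n<α))
  with j≡ ← proj₂ (∷-++-cancelʳ (2 + α ∷ X) m (P (2 + n))
               (trans (cong (2 + α ∷_) (sym P≡)) (trans (sym (ψ₁-suc α)) (trans e (cong (m ++_) (ψ₁-suc n))))))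
  = ⊥-elim (<-irrefl (sym j≡) n<j)

large∉ : ∀ π → {True (all? (_<? 3) π)} → ∀ m → 3 + m ∉ π
large∉ π {small} m 3+m∈π with s≤s (s≤s (s≤s ())) ← All.lookup (toWitness small) 3+m∈π

squareFree-P++20 : ∀ m → SquareFree (P (2 + m) ++ 2 ∷ 0 ∷ [])
squareFree-P++20 zero = squareFree-by-computation _
squareFree-P++20 (suc m) = subst SquareFree (sym (++-assoc (ruler (3 + m)) _ _))
  (squareFree-unique-letter (3 + m) (ruler (3 + m)) (P (2 + m) ++ 2 ∷ 0 ∷ [])
    (squareFree-ruler (3 + m)) (squareFree-P++20 m) (∉-ruler (3 + m) ≤-refl) (∉-++ (P (2 + m)) (∉-P (2 + m) ≤-refl) (large∉ _ m)))

-- Ruler words beyond the base cases split around a unique letter 3 + m, which a short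
-- factor over {0, 1, 2} cannot contain.
module Absence (π : Word)
  {small : True (all? (_<? 3) π)}
  {¬ε : False (factor? π [])}
  {¬ruler3 : False (factor? π (ruler 3))}
  {¬P2 : False (factor? π (P 2))}
  {¬ψ₁1 : False (factor? π (ψ₁ 1))} where

  ¬ruler : ∀ m → ¬ Factor π (ruler (3 + m))
  ¬ruler zero = toWitnessFalse ¬ruler3
  ¬ruler (suc m) f = [ ¬ruler m , ¬ruler m ]′ (factor-avoiding (ruler (3 + m)) (ruler (3 + m)) (large∉ π {small} m) f)

  ¬P : ∀ m → ¬ Factor π (P (2 + m))
  ¬P zero = toWitnessFalse ¬P2
  ¬P (suc m) f = [ ¬ruler m , ¬P m ]′ (factor-avoiding (ruler (3 + m)) (P (2 + m)) (large∉ π {small} m) f)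

  ¬ψ₁ : ∀ n → ¬ Factor π (ψ₁ (suc n))
  ¬ψ₁ zero = toWitnessFalse ¬ψ₁1
  ¬ψ₁ (suc n) f rewrite ψ₁-suc (suc n) =
    [ toWitnessFalse ¬ε , ¬P (suc n) ]′ (factor-avoiding [] (P (3 + n)) (large∉ π {small} n) f)

module Absent202 = Absence (2 ∷ 0 ∷ 2 ∷ [])
module Absent21 = Absence (2 ∷ 1 ∷ [])

ψ₁0-tail : Word
ψ₁0-tail = 0 ∷ 2 ∷ 1 ∷ 0 ∷ 1 ∷ []

-- ψ₁ (suc n) together with the parts of the neighbouring blocks ψ₁ 0 that a square starting
-- inside ψ₁ (suc n) can reach.
framed : ℕ → Word
framed n = ψ₁0-tail ++ ψ₁ (suc n) ++ 2 ∷ 0 ∷ []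

framed-suc : ∀ n → framed (suc n) ≡ ψ₁0-tail ++ 3 + n ∷ (ruler (3 + n) ++ 3 + n ∷ (P (2 + n) ++ 2 ∷ 0 ∷ []))
framed-suc n = trans (cong (λ t → ψ₁0-tail ++ t ++ 2 ∷ 0 ∷ []) (ψ₁-suc (suc n)))
                     (cong (λ t → ψ₁0-tail ++ 3 + n ∷ t) (++-assoc (ruler (3 + n)) _ _))

squareFree-framed : ∀ n → SquareFree (framed n)
squareFree-framed zero = squareFree-by-computation _
squareFree-framed (suc n) rewrite framed-suc n =
  squareFree-two-letters (3 + n) ψ₁0-tail (ruler (3 + n)) (P (2 + n) ++ 2 ∷ 0 ∷ [])
    (squareFree-by-computation _) (squareFree-ruler (3 + n)) (squareFree-P++20 n)
    (large∉ _ n) (∉-ruler (3 + n) ≤-refl) (∉-++ (P (2 + n)) (∉-P (2 + n) ≤-refl) (large∉ _ n)) ¬aligned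
  where
  ¬aligned : ∀ u y₁ y₂ v → ψ₁0-tail ≡ u ++ y₁ → ruler (3 + n) ≡ y₂ ++ y₁ → P (2 + n) ++ 2 ∷ 0 ∷ [] ≡ y₂ ++ v → ⊥
  ¬aligned u y₁ y₂ v tail≡ ruler≡ P20≡ with initLast y₁
  ... | [] = not-prefix (trans P20≡ (cong (_++ v) (trans (sym (++-identityʳ y₂)) (sym ruler≡))))
    where
    not-prefix : P (2 + n) ++ 2 ∷ 0 ∷ [] ≢ ruler (3 + n) ++ v
    not-prefix e with () ← ++-cancelˡ (P (2 + n)) _ _
      (trans e (trans (cong (_++ v) (ruler-suc (2 + n))) (++-assoc (P (2 + n)) _ v)))
  ... | y₁′ ∷ʳ′ l
    with refl ← proj₂ (∷ʳ-injective (0 ∷ 2 ∷ 1 ∷ 0 ∷ []) (u ++ y₁′) (trans tail≡ (sym (++-assoc u y₁′ _))))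
    with () ← proj₂ (∷ʳ-injective (P (2 + n)) (y₂ ++ y₁′)
                (trans (sym (ruler-suc (2 + n))) (trans ruler≡ (sym (++-assoc y₂ y₁′ _)))))

¬202-P++20 : ∀ m → ¬ Factor (2 ∷ 0 ∷ 2 ∷ []) (P (2 + m) ++ 2 ∷ 0 ∷ [])
¬202-P++20 zero = ¬factor-by-computation _ _
¬202-P++20 (suc m) f = [ Absent202.¬ruler m , ¬202-P++20 m ]′ (factor-avoiding (ruler (3 + m)) _ (large∉ _ m)
  (subst (Factor _) (++-assoc (ruler (3 + m)) _ _) f))

¬202-framed : ∀ n → ¬ Factor (2 ∷ 0 ∷ 2 ∷ []) (framed n)
¬202-framed zero = ¬factor-by-computation _ _
¬202-framed (suc n) f = [ ¬factor-by-computation _ _ , ¬202-P++20 (suc n) ]′ (factor-avoiding ψ₁0-tail _ (large∉ _ n)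
  (subst (Factor _) (cong (λ t → ψ₁0-tail ++ t ++ 2 ∷ 0 ∷ []) (ψ₁-suc (suc n))) f))

-- Grounded words alternate

isZero : ℕ → Bool
isZero zero = true
isZero (suc _) = false

Alternating : Word → Set
Alternating w = ∀ p a b q → w ≡ p ++ a ∷ b ∷ q → isZero b ≡ not (isZero a)

alternating-factor : ∀ {f w} → Alternating w → Factor f w → Alternating f
alternating-factor alt (u , v , refl) p a b q refl = alt (u ++ p) a b (q ++ v) (regroup u p (a ∷ b ∷ q) v)
  where
  regroup : ∀ (u p r v : Word) → u ++ (p ++ r) ++ v ≡ (u ++ p) ++ r ++ v
  regroup _ _ _ _ = solve (++-monoid ℕ)

alternating-∷ : ∀ x w → Alternating w → (∀ b q → w ≡ b ∷ q → isZero b ≡ not (isZero x)) → Alternating (x ∷ w)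
alternating-∷ x w alt first [] a b q e with refl , w≡ ← ∷-injective e = first b q w≡
alternating-∷ x w alt first (_ ∷ p) a b q e = alt p a b q (∷-injectiveʳ e)

mutual
  evenGrounded⇒alternating : ∀ w → EvenGrounded w → Alternating w
  evenGrounded⇒alternating [] _ [] _ _ _ ()
  evenGrounded⇒alternating [] _ (_ ∷ _) _ _ _ ()
  evenGrounded⇒alternating (x ∷ w) (refl , og) = alternating-∷ 0 w (oddGrounded⇒alternating w og) second
    where
    second : ∀ b q → w ≡ b ∷ q → isZero b ≡ false
    second zero q refl = ⊥-elim (proj₁ og refl)
    second (suc b) q refl = refl

  oddGrounded⇒alternating : ∀ w → OddGrounded w → Alternating w
  oddGrounded⇒alternating [] _ [] _ _ _ ()
  oddGrounded⇒alternating [] _ (_ ∷ _) _ _ _ ()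
  oddGrounded⇒alternating (zero ∷ w) (x≢0 , _) = ⊥-elim (x≢0 refl)
  oddGrounded⇒alternating (suc x ∷ w) (_ , eg) = alternating-∷ (suc x) w (evenGrounded⇒alternating w eg) second
    where
    second : ∀ b q → w ≡ b ∷ q → isZero b ≡ true
    second zero q refl = refl
    second (suc b) q refl with () ← proj₁ eg

grounded⇒alternating : ∀ w → Grounded w → Alternating w
grounded⇒alternating w (inj₁ eg) = evenGrounded⇒alternating w eg
grounded⇒alternating w (inj₂ og) = oddGrounded⇒alternating w og

ρ*-evenGrounded : ∀ w → EvenGrounded (ρ* w)
ρ*-evenGrounded [] = tt
ρ*-evenGrounded (x ∷ w) = refl , (λ ()) , ρ*-evenGrounded w

mutual
  evenGrounded-prefix : ∀ X {Y} → EvenGrounded (X ++ Y) → EvenGrounded X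
  evenGrounded-prefix [] _ = tt
  evenGrounded-prefix (x ∷ X) (x≡0 , og) = x≡0 , oddGrounded-prefix X og

  oddGrounded-prefix : ∀ X {Y} → OddGrounded (X ++ Y) → OddGrounded X
  oddGrounded-prefix [] _ = tt
  oddGrounded-prefix (x ∷ X) (x≢0 , eg) = x≢0 , evenGrounded-prefix X eg

P-evenGrounded : ∀ m → EvenGrounded (P m)
P-evenGrounded m = evenGrounded-prefix (P m) (subst EvenGrounded R≡ (ρ*-evenGrounded (R m)))
  where
  R≡ : R (suc m) ≡ P m ++ 0 ∷ suc m ∷ []
  R≡ = trans (R≡ruler (suc m)) (trans (cong (_++ suc m ∷ []) (ruler-suc m)) (++-assoc (P m) _ _))

ψ₁-alternating : ∀ n → Alternating (ψ₁ (suc n))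
ψ₁-alternating n = subst Alternating (sym (ψ₁-suc n)) (oddGrounded⇒alternating _ ((λ ()) , P-evenGrounded _))

leading : ℕ → ℕ
leading zero = 2
leading (suc n) = suc (suc n)

leading-head : ∀ x (w : Word) {t r} → ψ₁ x ++ w ≡ t ∷ r → leading x ≡ t
leading-head zero w e = ∷-injectiveˡ e
leading-head (suc n) w e = ∷-injectiveˡ e

leading-injective : ∀ a b → isZero a ≡ isZero b → leading a ≡ leading b → a ≡ b
leading-injective zero zero _ _ = refl
leading-injective (suc a) (suc b) _ refl = refl

-- Synchronisation

ψ₁*-∷ʳ : ∀ w a → ψ₁* (w ++ a ∷ []) ≡ ψ₁* w ++ ψ₁ a
ψ₁*-∷ʳ w a = trans (concatMap-++ ψ₁ w (a ∷ [])) (cong (ψ₁* w ++_) (++-identityʳ (ψ₁ a)))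

ψ₁*-last : ∀ w (E m : Word) → ψ₁* w ≡ E ++ m → m ≢ [] → Σ Word λ m′ → m ≡ m′ ++ 1 ∷ []
ψ₁*-last w E m e m≢[] with initLast w
... | [] = ⊥-elim (m≢[] (++-conicalʳ E m (sym e)))
... | w′ ∷ʳ′ b with X , ψb≡ ← ψ₁-ends-with-1 b =
  ∷ʳ-suffix (ψ₁* w′ ++ X) E m
    (trans (++-assoc (ψ₁* w′) X _) (trans (cong (ψ₁* w′ ++_) (sym ψb≡)) (trans (sym (ψ₁*-∷ʳ w′ b)) e))) m≢[]

ends-with-suc : ∀ w n E → Alternating (w ++ 0 ∷ []) → ψ₁* w ≡ E ++ ψ₁ (suc n) → Σ Word λ w′ → w ≡ w′ ++ suc n ∷ []
ends-with-suc w n E alt e with initLast w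
... | [] with () ← ++-conicalʳ E (ψ₁ (suc n)) (sym e)
... | w′ ∷ʳ′ zero with () ← alt w′ 0 0 [] (++-assoc w′ (0 ∷ []) (0 ∷ []))
... | w′ ∷ʳ′ suc α with levi (ψ₁* w′) (ψ₁ (suc α)) E (ψ₁ (suc n)) (trans (sym (ψ₁*-∷ʳ w′ (suc α))) e)
...   | inj₁ (m , _ , ψα≡) rewrite ψ₁-suffix-injective α n m ψα≡ = w′ , refl
...   | inj₂ (m , ψw′≡ , ψn≡ , m≢[]) with m′ , refl ← ψ₁*-last w′ E m ψw′≡ m≢[]
  with () ← ψ₁-alternating n m′ 1 (2 + α) (P (2 + α))
              (trans ψn≡ (trans (cong (λ t → (m′ ++ 1 ∷ []) ++ t) (ψ₁-suc α)) (++-assoc m′ (1 ∷ []) _)))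

202-only-at-start : ∀ p m → ψ₁ 0 ≡ p ++ 2 ∷ 0 ∷ 2 ∷ m → p ≡ []
202-only-at-start [] m e = refl
202-only-at-start (x ∷ p) m e = ⊥-elim (¬factor-by-computation (2 ∷ 0 ∷ 2 ∷ []) ψ₁0-tail (p , m , ∷-injectiveʳ e))

202-no-prefix-ending-in-1 : ∀ m′ m₂ → 2 ∷ 0 ∷ 2 ∷ [] ≢ (m′ ++ 1 ∷ []) ++ m₂
202-no-prefix-ending-in-1 [] m₂ ()
202-no-prefix-ending-in-1 (_ ∷ []) m₂ ()
202-no-prefix-ending-in-1 (_ ∷ _ ∷ []) m₂ ()
202-no-prefix-ending-in-1 (_ ∷ _ ∷ _ ∷ []) m₂ ()
202-no-prefix-ending-in-1 (_ ∷ _ ∷ _ ∷ _ ∷ m′) m₂ ()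

202-decodes : ∀ w p q → ψ₁* w ≡ p ++ 2 ∷ 0 ∷ 2 ∷ q →
  Σ Word λ w₁ → Σ Word λ w₂ → w ≡ w₁ ++ 0 ∷ w₂ × p ≡ ψ₁* w₁
202-decodes [] p q e with () ← ++-conicalʳ p _ (sym e)
202-decodes (b ∷ w) p q e with levi (ψ₁ b) (ψ₁* w) p (2 ∷ 0 ∷ 2 ∷ q) e
... | inj₁ (m , p≡ , ψw≡) with w₁ , w₂ , refl , refl ← 202-decodes w m q ψw≡ = b ∷ w₁ , w₂ , refl , p≡
... | inj₂ (m , ψb≡ , 202q≡ , m≢[]) with levi (2 ∷ 0 ∷ 2 ∷ []) q m (ψ₁* w) 202q≡
...   | inj₂ (m₂ , 202≡ , _ , _) with X , ψb≡X1 ← ψ₁-ends-with-1 b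
  with m′ , refl ← ∷ʳ-suffix X p m (trans (sym ψb≡X1) ψb≡) m≢[] = ⊥-elim (202-no-prefix-ending-in-1 m′ m₂ 202≡)
...   | inj₁ (m₂ , m≡ , _) with b
...     | suc n = ⊥-elim (Absent202.¬ψ₁ n (p , m₂ , trans ψb≡ (cong (p ++_) m≡)))
...     | zero with refl ← 202-only-at-start p m₂ (trans ψb≡ (cong (p ++_) m≡)) = [] , w , refl , refl

HeadsAgree : Word → Word → Set
HeadsAgree x w = ∀ a b xs ws → x ≡ a ∷ xs → w ≡ b ∷ ws → isZero a ≡ isZero b

headsAgree-tails : ∀ a x w → Alternating (a ∷ x) → Alternating (a ∷ w) → HeadsAgree x w
headsAgree-tails a x w altx altw b b′ xs ws refl refl = trans (altx [] a b xs refl) (sym (altw [] a b′ ws refl))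

-- Decoding from the left: while the common prefix t lasts, x and w consist of the same letters.
common-prefix-synchronises : ∀ x w t s f → HeadsAgree x w → Alternating x → Alternating w →
  ψ₁* x ≡ t ++ s → ψ₁* w ≡ t ++ f →
  Σ Word λ xa → Σ Word λ xb → Σ Word λ wb → Σ Word λ s₀ → x ≡ xa ++ xb × w ≡ xa ++ wb × s ≡ s₀ ++ ψ₁* xb
common-prefix-synchronises [] w [] s f _ _ _ ψx≡ _ = [] , [] , w , [] , refl , refl , sym ψx≡
common-prefix-synchronises (x₁ ∷ x) w [] s f _ _ _ ψx≡ _ = [] , x₁ ∷ x , w , [] , refl , refl , sym ψx≡
common-prefix-synchronises (x₁ ∷ x) (b ∷ w) (t₁ ∷ t) s f agree altx altw ψx≡ ψw≡
  with refl ← leading-injective x₁ b (agree x₁ b x w refl refl) (trans (leading-head x₁ _ ψx≡) (sym (leading-head b _ ψw≡)))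
  with levi (ψ₁ x₁) (ψ₁* x) (t₁ ∷ t) s ψx≡
... | inj₂ (m , _ , s≡ , _) = x₁ ∷ [] , x , w , m , refl , refl , s≡
... | inj₁ (m , t≡ , ψx′≡)
  with xa , xb , wb , s₀ , refl , refl , s≡ ← common-prefix-synchronises x w m s f (headsAgree-tails x₁ x w altx altw)
         (alternating-factor altx (suffix-factor (x₁ ∷ []) x)) (alternating-factor altw (suffix-factor (x₁ ∷ []) w))
         ψx′≡ (++-cancelˡ (ψ₁ x₁) _ _ (trans ψw≡ (trans (cong (_++ f) t≡) (++-assoc (ψ₁ x₁) m f))))
  = x₁ ∷ xa , xb , wb , s₀ , refl , refl , s≡

-- Squares in ψ₁-images of grounded words

ZeroHeaded : Word → Set
ZeroHeaded w = w ≡ [] ⊎ Σ Word λ w′ → w ≡ 0 ∷ w′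

square-within : ∀ {s′ w r y z} → y ≢ [] → ZeroHeaded w →
  SquareFree (s′ ++ 2 ∷ 0 ∷ []) → ¬ Factor (2 ∷ 0 ∷ 2 ∷ []) s′ →
  s′ ≡ y ++ r → y ++ z ≡ r ++ ψ₁* w → ⊥
square-within {s′} {w} {r} {y} {z} y≢[] zh sf ¬202 s′≡ yz≡ with levi y z r (ψ₁* w) yz≡
... | inj₁ (r′ , refl , _) =
  sf ([] , y , r′ ++ 2 ∷ 0 ∷ [] , y≢[] , trans (cong (_++ 2 ∷ 0 ∷ []) s′≡) (regroup y r′ (2 ∷ 0 ∷ [])))
  where
  regroup : ∀ (Y R T : Word) → (Y ++ Y ++ R) ++ T ≡ (Y ++ Y) ++ R ++ T
  regroup _ _ _ = solve (++-monoid ℕ)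
... | inj₂ (q , y≡ , ψw≡ , q≢[]) with zh
...   | inj₁ refl = q≢[] (++-conicalˡ q z (sym ψw≡))
...   | inj₂ (w′ , refl) with q | ψw≡
...     | [] | _ = q≢[] refl
...     | _ ∷ [] | ψw≡′ with refl ← ∷-injectiveˡ ψw≡′ = sf ([] , y , 0 ∷ [] , y≢[] , (begin
  s′ ++ 2 ∷ 0 ∷ []           ≡⟨ cong (_++ 2 ∷ 0 ∷ []) s′≡ ⟩
  (y ++ r) ++ 2 ∷ 0 ∷ []     ≡⟨ regroup y r ⟩
  y ++ (r ++ 2 ∷ []) ++ 0 ∷ [] ≡⟨ cong (λ v → y ++ v ++ 0 ∷ []) (sym y≡) ⟩
  y ++ y ++ 0 ∷ []           ≡⟨ ++-assoc y y _ ⟨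
  (y ++ y) ++ 0 ∷ []         ∎))
  where
  regroup : ∀ (Y R : Word) → (Y ++ R) ++ 2 ∷ 0 ∷ [] ≡ Y ++ (R ++ 2 ∷ []) ++ 0 ∷ []
  regroup Y R = trans (++-assoc Y R _) (cong (Y ++_) (sym (++-assoc R (2 ∷ []) _)))
...     | _ ∷ _ ∷ [] | ψw≡′ with refl , ψw≡″ ← ∷-injective ψw≡′ with refl ← ∷-injectiveˡ ψw≡″ =
  sf ([] , y , [] , y≢[] , (begin
  s′ ++ 2 ∷ 0 ∷ []           ≡⟨ cong (_++ 2 ∷ 0 ∷ []) s′≡ ⟩
  (y ++ r) ++ 2 ∷ 0 ∷ []     ≡⟨ ++-assoc y r _ ⟩
  y ++ r ++ 2 ∷ 0 ∷ []       ≡⟨ cong (y ++_) (sym y≡) ⟩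
  y ++ y                     ≡⟨ ++-identityʳ _ ⟨
  (y ++ y) ++ []             ∎))
...     | _ ∷ _ ∷ _ ∷ q″ | ψw≡′ with refl , ψw≡″ ← ∷-injective ψw≡′ with refl , ψw≡‴ ← ∷-injective ψw≡″
  with refl ← ∷-injectiveˡ ψw≡‴ =
  ¬202 (r , q″ ++ r , trans s′≡ (trans (cong (_++ r) y≡) (++-assoc r _ r)))

-- A square with half s t, where s ends ψ₁* w₁ and t begins both ψ₁* (0 ∷ x) and ψ₁* (0 ∷ w₃):
-- decoding t from the left and s from the right yields a square in w₁ ++ 0 ∷ x ++ 0 ∷ w₃.
conjugate-square : ∀ w₁ x w₃ {e s t f} →
  SquareFree (w₁ ++ (0 ∷ x) ++ 0 ∷ w₃) → Alternating (w₁ ++ (0 ∷ x) ++ 0 ∷ w₃) →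
  ψ₁* w₁ ≡ e ++ s → ψ₁* (0 ∷ x) ≡ t ++ s → ψ₁* (0 ∷ w₃) ≡ t ++ f → ¬ Factor (2 ∷ 0 ∷ 2 ∷ []) s → ⊥
conjugate-square w₁ x w₃ {e} {s} {t} {f} sf alt ψw₁≡ ψx≡ ψw₃≡ ¬202
  with common-prefix-synchronises (0 ∷ x) (0 ∷ w₃) t s f (λ { _ _ _ _ refl refl → refl })
         (alternating-factor alt (factor-trans (prefix-factor (0 ∷ x) (0 ∷ w₃)) (suffix-factor w₁ _)))
         (alternating-factor alt (factor-trans (suffix-factor (0 ∷ x) (0 ∷ w₃)) (suffix-factor w₁ _)))
         ψx≡ ψw₃≡
... | xa , [] , wb , s₀ , x≡ , w₃≡ , _ = sf (w₁ , 0 ∷ x , wb , (λ ()) , (begin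
  w₁ ++ (0 ∷ x) ++ 0 ∷ w₃         ≡⟨ cong (λ v → w₁ ++ (0 ∷ x) ++ v) w₃≡ ⟩
  w₁ ++ (0 ∷ x) ++ xa ++ wb       ≡⟨ cong (λ v → w₁ ++ (0 ∷ x) ++ v ++ wb) (trans (sym (++-identityʳ xa)) (sym x≡)) ⟩
  w₁ ++ (0 ∷ x) ++ (0 ∷ x) ++ wb  ≡⟨ cong (w₁ ++_) (++-assoc (0 ∷ x) (0 ∷ x) wb) ⟨
  w₁ ++ ((0 ∷ x) ++ 0 ∷ x) ++ wb  ∎))
... | xa , zero ∷ r , wb , s₀ , _ , _ , s≡ = ¬202 (s₀ , 1 ∷ 0 ∷ 1 ∷ ψ₁* r , s≡)
... | xa , suc a ∷ zero ∷ r , wb , s₀ , _ , _ , s≡ =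
  ¬202 (s₀ ++ ψ₁ (suc a) , 1 ∷ 0 ∷ 1 ∷ ψ₁* r , trans s≡ (sym (++-assoc s₀ (ψ₁ (suc a)) _)))
... | xa , suc a ∷ suc b ∷ r , wb , s₀ , x≡ , _ , _
  with () ← alternating-factor alt (factor-trans (prefix-factor (0 ∷ x) (0 ∷ w₃)) (suffix-factor w₁ _)) xa (suc a) (suc b) r x≡
... | xa , suc a ∷ [] , wb , s₀ , x≡ , w₃≡ , s≡
  with w₁′ , refl ← ends-with-suc w₁ a (e ++ s₀)
         (alternating-factor alt ([] , x ++ 0 ∷ w₃ , sym (++-assoc w₁ (0 ∷ []) _)))
         (trans ψw₁≡ (trans (cong (e ++_) (trans s≡ (cong (s₀ ++_) (++-identityʳ _)))) (sym (++-assoc e s₀ _))))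
  = sf (w₁′ , suc a ∷ xa , wb , (λ ()) , trans (cong₂ (λ v v′ → (w₁′ ++ suc a ∷ []) ++ v ++ v′) x≡ w₃≡)
                                               (regroup w₁′ (suc a ∷ []) xa wb))
  where
  regroup : ∀ (W A X B : Word) → (W ++ A) ++ (X ++ A) ++ (X ++ B) ≡ W ++ ((A ++ X) ++ (A ++ X)) ++ B
  regroup _ _ _ _ = solve (++-monoid ℕ)

square-across-202 : ∀ w₁ w {u s′ t z} → SquareFree (w₁ ++ 0 ∷ w) → Alternating (w₁ ++ 0 ∷ w) →
  ¬ Factor (2 ∷ 0 ∷ 2 ∷ []) s′ → u ++ s′ ≡ ψ₁* w₁ →
  ψ₁* (0 ∷ w) ≡ ((2 ∷ 0 ∷ 2 ∷ t) ++ s′) ++ 2 ∷ 0 ∷ 2 ∷ t ++ z → ⊥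
square-across-202 w₁ w {s′ = s′} {t} {z} sf alt ¬202 us′≡ ψw≡ with 202-decodes (0 ∷ w) ((2 ∷ 0 ∷ 2 ∷ t) ++ s′) (t ++ z) ψw≡
... | [] , _ , _ , ()
... | _ ∷ x , w₃ , w≡ , Ts′≡ with refl , refl ← ∷-injective w≡ =
  conjugate-square w₁ x w₃ sf alt (sym us′≡) (sym Ts′≡) (++-cancelˡ (T ++ s′) _ _ (begin
    (T ++ s′) ++ ψ₁* (0 ∷ w₃)           ≡⟨ cong (_++ ψ₁* (0 ∷ w₃)) Ts′≡ ⟩
    ψ₁* (0 ∷ x) ++ ψ₁* (0 ∷ w₃)         ≡⟨ concatMap-++ ψ₁ (0 ∷ x) (0 ∷ w₃) ⟨
    ψ₁* (0 ∷ x ++ 0 ∷ w₃)               ≡⟨ ψw≡ ⟩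
    (T ++ s′) ++ T ++ z                 ∎)) ¬202
  where
  T = 2 ∷ 0 ∷ 2 ∷ t

-- A square starting at the suffix s′ of ψ₁* w₁ survives only with half s′ 2 or s′ 20; these two
-- cases depend on the last letters of w₁ and are excluded separately.
square-at-suffix : ∀ w₁ w {u s′ y z} → SquareFree (w₁ ++ w) → Alternating (w₁ ++ w) → ZeroHeaded w →
  SquareFree (s′ ++ 2 ∷ 0 ∷ []) → ¬ Factor (2 ∷ 0 ∷ 2 ∷ []) s′ → u ++ s′ ≡ ψ₁* w₁ →
  y ≢ [] → (y ++ y) ++ z ≡ s′ ++ ψ₁* w →
  Σ Word λ w′ → w ≡ 0 ∷ w′ × (s′ ++ 2 ∷ z ≡ ψ₁0-tail ++ ψ₁* w′ ⊎ s′ ++ 2 ∷ 0 ∷ z ≡ 2 ∷ 1 ∷ 0 ∷ 1 ∷ ψ₁* w′)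
square-at-suffix w₁ w {s′ = s′} {y} {z} sf alt zh sf′ ¬202 us′≡ y≢[] e
  with levi y (y ++ z) s′ (ψ₁* w) (trans (sym (++-assoc y y z)) e)
... | inj₁ (r , s′≡ , yz≡) = ⊥-elim (square-within y≢[] zh sf′ ¬202 s′≡ yz≡)
... | inj₂ (t , y≡ , ψw≡ , t≢[]) with zh
...   | inj₁ refl = ⊥-elim (t≢[] (++-conicalˡ t _ (sym ψw≡)))
...   | inj₂ (w′ , refl) with t | ψw≡
...     | [] | _ = ⊥-elim (t≢[] refl)
...     | _ ∷ [] | ψw≡′ with refl , ψw≡″ ← ∷-injective ψw≡′ =
  w′ , refl , inj₁ (trans (trans (sym (++-assoc s′ (2 ∷ []) z)) (cong (_++ z) (sym y≡))) (sym ψw≡″))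
...     | _ ∷ _ ∷ [] | ψw≡′ with refl , ψw≡″ ← ∷-injective ψw≡′ with refl , ψw≡‴ ← ∷-injective ψw≡″ =
  w′ , refl , inj₂ (trans (trans (sym (++-assoc s′ (2 ∷ 0 ∷ []) z)) (cong (_++ z) (sym y≡))) (sym ψw≡‴))
...     | _ ∷ _ ∷ _ ∷ t″ | ψw≡′ with refl , ψw≡″ ← ∷-injective ψw≡′ with refl , ψw≡‴ ← ∷-injective ψw≡″
  with refl ← ∷-injectiveˡ ψw≡‴ = ⊥-elim (square-across-202 w₁ w′ sf alt ¬202 us′≡ (begin
    ψ₁* (0 ∷ w′)                       ≡⟨ ψw≡′ ⟩
    T ++ y ++ z                        ≡⟨ cong (λ v → T ++ v ++ z) y≡ ⟩
    T ++ (s′ ++ T) ++ z                ≡⟨ regroup T s′ z ⟩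
    (T ++ s′) ++ T ++ z                ∎))
  where
  T = 2 ∷ 0 ∷ 2 ∷ t″
  regroup : ∀ (T S Z : Word) → T ++ (S ++ T) ++ Z ≡ (T ++ S) ++ T ++ Z
  regroup _ _ _ = solve (++-monoid ℕ)

zeroHeaded-after-nonzero : ∀ a w → Alternating (suc a ∷ w) → ZeroHeaded w
zeroHeaded-after-nonzero a [] _ = inj₁ refl
zeroHeaded-after-nonzero a (zero ∷ w) _ = inj₂ (w , refl)
zeroHeaded-after-nonzero a (suc c ∷ w) alt with () ← alt [] (suc a) (suc c) w refl

overlap-021 : ∀ m z X → m ≢ [] → m ++ 2 ∷ z ≡ 0 ∷ 2 ∷ 1 ∷ X → m ≡ 0 ∷ [] ⊎ Factor (2 ∷ 1 ∷ []) m
overlap-021 [] z X m≢[] e = ⊥-elim (m≢[] refl)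
overlap-021 (_ ∷ []) z X _ e with refl ← ∷-injectiveˡ e = inj₁ refl
overlap-021 (_ ∷ _ ∷ []) z X _ e with () ← ∷-injectiveˡ (∷-injectiveʳ (∷-injectiveʳ e))
overlap-021 (_ ∷ _ ∷ _ ∷ m) z X _ e with refl , e′ ← ∷-injective (∷-injectiveʳ e) with refl ← ∷-injectiveˡ e′ =
  inj₂ (_ ∷ [] , m , refl)

overlap-21 : ∀ m z X → m ≢ [] → m ++ 2 ∷ 0 ∷ z ≡ 2 ∷ 1 ∷ X → Factor (2 ∷ 1 ∷ []) m
overlap-21 [] z X m≢[] e = ⊥-elim (m≢[] refl)
overlap-21 (_ ∷ []) z X _ e with () ← ∷-injectiveˡ (∷-injectiveʳ e)
overlap-21 (_ ∷ _ ∷ m) z X _ e with refl , e′ ← ∷-injective e with refl ← ∷-injectiveˡ e′ = [] , m , refl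

no-square-from-nonzero : ∀ β w {u m y z} → SquareFree (suc β ∷ w) → Alternating (suc β ∷ w) →
  ψ₁ (suc β) ≡ u ++ m → m ≢ [] → y ≢ [] → (y ++ y) ++ z ≡ m ++ ψ₁* w → ⊥
no-square-from-nonzero β w {u} {m} sf alt ψβ≡ m≢[] y≢[] e
  with square-at-suffix (suc β ∷ []) w sf alt (zeroHeaded-after-nonzero β w alt)
         (squareFree-factor (squareFree-framed β) (subst (Factor _) (sym framed≡) (suffix-factor (ψ₁0-tail ++ u) _)))
         (λ f → ¬202-framed β (factor-trans f (ψ₁0-tail ++ u , 2 ∷ 0 ∷ [] , framed≡)))
         (trans (sym ψβ≡) (sym (++-identityʳ _))) y≢[] e
  where
  framed≡ : framed β ≡ (ψ₁0-tail ++ u) ++ m ++ 2 ∷ 0 ∷ []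
  framed≡ = trans (cong (λ v → ψ₁0-tail ++ v ++ 2 ∷ 0 ∷ []) ψβ≡) (regroup ψ₁0-tail u m (2 ∷ 0 ∷ []))
    where
    regroup : ∀ (A U M T : Word) → A ++ (U ++ M) ++ T ≡ (A ++ U) ++ M ++ T
    regroup _ _ _ _ = solve (++-monoid ℕ)
... | w₄ , refl , inj₁ e′ with overlap-021 m _ _ m≢[] e′
...   | inj₂ 21⊑m = Absent21.¬ψ₁ β (factor-trans 21⊑m (subst (Factor m) (sym ψβ≡) (suffix-factor u m)))
...   | inj₁ refl with X , ψβ≡X1 ← ψ₁-ends-with-1 (suc β)
  with () ← proj₂ (∷ʳ-injective X u (trans (sym ψβ≡X1) ψβ≡))
no-square-from-nonzero β w {u} {m} sf alt ψβ≡ m≢[] y≢[] e | w₄ , refl , inj₂ e′ =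
  Absent21.¬ψ₁ β (factor-trans (overlap-21 m _ _ m≢[] e′) (subst (Factor m) (sym ψβ≡) (suffix-factor u m)))

repeated-nonzero : ∀ α w {Z} → SquareFree (0 ∷ suc α ∷ 0 ∷ w) → Alternating (0 ∷ suc α ∷ 0 ∷ w) →
  ψ₁ (suc α) ++ Z ≡ ψ₁* w → ⊥
repeated-nonzero α [] sf alt ()
repeated-nonzero α (a ∷ w) sf alt e
  with refl ← leading-injective a (suc α) (alt (0 ∷ suc α ∷ []) 0 a w refl) (leading-head a (ψ₁* w) (sym e))
  = sf ([] , 0 ∷ suc α ∷ [] , w , (λ ()) , refl)

overlap-tail : ∀ α w u′ m {Z} → SquareFree (0 ∷ suc α ∷ 0 ∷ w) → Alternating (0 ∷ suc α ∷ 0 ∷ w) →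
  ψ₁0-tail ≡ u′ ++ m → m ≢ [] → (m ++ ψ₁ (suc α)) ++ Z ≡ ψ₁0-tail ++ ψ₁* w → ⊥
overlap-tail α w [] _ {Z} sf alt refl _ e =
  repeated-nonzero α w sf alt (++-cancelˡ ψ₁0-tail _ _ (trans (sym (++-assoc ψ₁0-tail (ψ₁ (suc α)) Z)) e))
overlap-tail α w (_ ∷ []) _ _ _ refl _ ()
overlap-tail α w (_ ∷ _ ∷ []) _ _ _ refl _ ()
overlap-tail α w (_ ∷ _ ∷ _ ∷ []) _ _ _ refl _ ()
overlap-tail α w (_ ∷ _ ∷ _ ∷ _ ∷ []) _ _ _ refl _ ()
overlap-tail α w (_ ∷ _ ∷ _ ∷ _ ∷ _ ∷ []) _ _ _ refl m≢[] _ = m≢[] refl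

overlap-2101 : ∀ α w u′ m {Z} → SquareFree (0 ∷ suc α ∷ 0 ∷ w) → Alternating (0 ∷ suc α ∷ 0 ∷ w) →
  ψ₁0-tail ≡ u′ ++ m → m ≢ [] → (m ++ ψ₁ (suc α)) ++ Z ≡ 2 ∷ 1 ∷ 0 ∷ 1 ∷ ψ₁* w → ⊥
overlap-2101 α w [] _ _ _ refl _ ()
overlap-2101 α w (_ ∷ []) _ {Z} sf alt refl _ e =
  repeated-nonzero α w sf alt
    (++-cancelˡ (2 ∷ 1 ∷ 0 ∷ 1 ∷ []) _ _ (trans (sym (++-assoc (2 ∷ 1 ∷ 0 ∷ 1 ∷ []) (ψ₁ (suc α)) Z)) e))
overlap-2101 α w (_ ∷ _ ∷ []) _ _ _ refl _ ()
overlap-2101 α w (_ ∷ _ ∷ _ ∷ []) _ _ _ refl _ ()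
overlap-2101 α w (_ ∷ _ ∷ _ ∷ _ ∷ []) _ _ _ refl _ ()
overlap-2101 α w (_ ∷ _ ∷ _ ∷ _ ∷ _ ∷ []) _ _ _ refl m≢[] _ = m≢[] refl

no-square-from-zero : ∀ w {u m y z} → SquareFree (0 ∷ w) → Alternating (0 ∷ w) →
  ψ₁ 0 ≡ u ++ m → m ≢ [] → y ≢ [] → (y ++ y) ++ z ≡ m ++ ψ₁* w → ⊥
no-square-from-zero w {[]} sf alt refl _ y≢[] e
  with square-at-suffix [] (0 ∷ w) {u = []} {s′ = []} sf alt (inj₂ (w , refl))
         (squareFree-by-computation _) (¬factor-by-computation _ _) refl y≢[] e
... | _ , _ , inj₁ ()
... | _ , _ , inj₂ ()
no-square-from-zero [] {_ ∷ u′} {m} sf alt ψ0≡ m≢[] y≢[] e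
  with refl , tail≡ ← ∷-injective ψ0≡
  with square-at-suffix (0 ∷ []) [] sf alt (inj₁ refl)
         (squareFree-factor (squareFree-by-computation (ψ₁0-tail ++ 2 ∷ 0 ∷ []))
           (u′ , [] , trans (cong (_++ 2 ∷ 0 ∷ []) tail≡) (regroup u′ m (2 ∷ 0 ∷ []))))
         (λ f → ¬factor-by-computation _ ψ₁0-tail (factor-trans f (u′ , [] , trans tail≡ (cong (u′ ++_) (sym (++-identityʳ m))))))
         (trans (sym ψ0≡) (sym (++-identityʳ _))) y≢[] e
  where
  regroup : ∀ (U M T : Word) → (U ++ M) ++ T ≡ U ++ (M ++ T) ++ []
  regroup _ _ _ = solve (++-monoid ℕ)
... | _ , () , _
no-square-from-zero (zero ∷ w) {_ ∷ _} _ alt _ _ _ _ with () ← alt [] 0 0 w refl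
no-square-from-zero (suc α ∷ w) {_ ∷ u′} {m} sf alt ψ0≡ m≢[] y≢[] e
  with refl , tail≡ ← ∷-injective ψ0≡
  with square-at-suffix (0 ∷ suc α ∷ []) w {u = 2 ∷ u′} {s′ = m ++ ψ₁ (suc α)} sf alt
         (zeroHeaded-after-nonzero α w (alternating-factor alt (suffix-factor (0 ∷ []) _)))
         (squareFree-factor (squareFree-framed α) (subst (Factor _) (sym (framed≡ tail≡)) (suffix-factor u′ _)))
         (λ f → ¬202-framed α (factor-trans f (u′ , 2 ∷ 0 ∷ [] , framed≡ tail≡)))
         (cong (2 ∷_) (block≡ tail≡)) y≢[] (trans e (sym (++-assoc m (ψ₁ (suc α)) _)))
  where
  framed≡ : ψ₁0-tail ≡ u′ ++ m → framed α ≡ u′ ++ (m ++ ψ₁ (suc α)) ++ 2 ∷ 0 ∷ []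
  framed≡ tail≡ = trans (cong (_++ ψ₁ (suc α) ++ 2 ∷ 0 ∷ []) tail≡) (regroup u′ m (ψ₁ (suc α)) (2 ∷ 0 ∷ []))
    where
    regroup : ∀ (U M A T : Word) → (U ++ M) ++ A ++ T ≡ U ++ (M ++ A) ++ T
    regroup _ _ _ _ = solve (++-monoid ℕ)
  block≡ : ψ₁0-tail ≡ u′ ++ m → u′ ++ m ++ ψ₁ (suc α) ≡ ψ₁0-tail ++ ψ₁ (suc α) ++ []
  block≡ tail≡ = trans (regroup u′ m (ψ₁ (suc α))) (cong (_++ ψ₁ (suc α) ++ []) (sym tail≡))
    where
    regroup : ∀ (U M A : Word) → U ++ M ++ A ≡ (U ++ M) ++ A ++ []
    regroup _ _ _ = solve (++-monoid ℕ)
... | w₄ , refl , inj₁ e′ = overlap-tail α w₄ u′ m sf alt tail≡ m≢[] e′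
... | w₄ , refl , inj₂ e′ = overlap-2101 α w₄ u′ m sf alt tail≡ m≢[] e′

no-square-in-image : ∀ w u y z → SquareFree w → Alternating w → y ≢ [] → ψ₁* w ≢ u ++ (y ++ y) ++ z
no-square-in-image [] u [] z _ _ y≢[] _ = y≢[] refl
no-square-in-image [] u (_ ∷ _) z _ _ _ e with () ← ++-conicalʳ u _ (sym e)
no-square-in-image (b ∷ w) u y z sf alt y≢[] e with levi (ψ₁ b) (ψ₁* w) u _ e
... | inj₁ (m , _ , e′) = no-square-in-image w m y z (squareFree-factor sf (suffix-factor (b ∷ []) w))
                            (alternating-factor alt (suffix-factor (b ∷ []) w)) y≢[] e′
... | inj₂ (m , ψb≡ , e′ , m≢[]) with b
...   | zero = no-square-from-zero w sf alt ψb≡ m≢[] y≢[] e′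
...   | suc β = no-square-from-nonzero β w sf alt ψb≡ m≢[] y≢[] e′

ψ₁-nonErasing : NonErasing ψ₁
ψ₁-nonErasing zero ()
ψ₁-nonErasing (suc n) ()

proposition3p5 : SquareFreeOverGrounded ψ₁
proposition3p5 = ψ₁-nonErasing , λ w sf grounded (u , y , v , y≢[] , e) →
  no-square-in-image w u y v sf (grounded⇒alternating w grounded) y≢[] e
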